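{- Let $L_0,L_1$ be lattices, $L:=L_0\times L_1$, and $\pi_i:L\to L_i$ the projections. Then the map $\pi:\mathcal{C}_L(L)\to\mathcal{C}_L(L_0)\times\mathcal{C}_L(L_1)$ defined by $\pi(S):=(\pi_0[S],\pi_1[S])$ is an isomorphism from $\mathcal{C}_L(L)$ onto $\mathcal{C}_L(L_0)\times\mathcal{C}_L(L_1)$.
   Context: For a lattice $T$, $\mathcal{C}_L(T)$ is the set of nonempty convex sublattices of $T$ ordered by the bi-dominating order ($X\le Y$ iff every element of $X$ is below some element of $Y$ and every element of $Y$ is above some element of $X$). Products carry the componentwise order; $\pi_i[S]$ denotes the image of $S$. -}

module Defs where

open import Level using (Level; _⊔_)
open import Data.Product using (Σ; ∃; _×_; _,_; proj₁; proj₂)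
open import Relation.Unary using (Pred)
open import Relation.Binary.Lattice using (Lattice)

module _ {a ℓ : Level} {A : Set a} (_≤_ : A → A → Set ℓ) (_∧_ _∨_ : A → A → A) where

  record IsConvexSublattice {p : Level} (S : Pred A p) : Set (a ⊔ ℓ ⊔ p) where
    field
      nonempty : ∃ λ x → S x
      ∧-closed : ∀ {x y} → S x → S y → S (x ∧ y)
      ∨-closed : ∀ {x y} → S x → S y → S (x ∨ y)
      convex   : ∀ {x y z} → S x → S z → x ≤ y → y ≤ z → S y

BiDom : ∀ {a ℓ p q} {A : Set a} (_≤_ : A → A → Set ℓ) →
        Pred A p → Pred A q → Set (a ⊔ ℓ ⊔ p ⊔ q)
BiDom _≤_ X Y =
  (∀ {x} → X x → ∃ λ y → Y y × (x ≤ y)) ×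
  (∀ {y} → Y y → ∃ λ x → X x × (x ≤ y))

Image : ∀ {a b ℓ p} {A : Set a} {B : Set b} (_≈_ : B → B → Set ℓ) →
        (A → B) → Pred A p → Pred B (a ⊔ ℓ ⊔ p)
Image _≈_ f S y = ∃ λ x → S x × (f x ≈ y)

module Product {c₀ ℓ₀ ℓ₀' c₁ ℓ₁ ℓ₁' : Level}
               (L₀ : Lattice c₀ ℓ₀ ℓ₀') (L₁ : Lattice c₁ ℓ₁ ℓ₁') where
  private
    module L₀ = Lattice L₀
    module L₁ = Lattice L₁

  Carrier : Set (c₀ ⊔ c₁)
  Carrier = L₀.Carrier × L₁.Carrier

  _≤_ : Carrier → Carrier → Set (ℓ₀' ⊔ ℓ₁')
  (x₀ , x₁) ≤ (y₀ , y₁) = (x₀ L₀.≤ y₀) × (x₁ L₁.≤ y₁)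

  _∧_ : Carrier → Carrier → Carrier
  (x₀ , x₁) ∧ (y₀ , y₁) = (x₀ L₀.∧ y₀) , (x₁ L₁.∧ y₁)

  _∨_ : Carrier → Carrier → Carrier
  (x₀ , x₁) ∨ (y₀ , y₁) = (x₀ L₀.∨ y₀) , (x₁ L₁.∨ y₁)

  π₀ : ∀ {p} → Pred Carrier p → Pred L₀.Carrier (c₀ ⊔ c₁ ⊔ ℓ₀ ⊔ p)
  π₀ = Image L₀._≈_ proj₁

  π₁ : ∀ {p} → Pred Carrier p → Pred L₁.Carrier (c₀ ⊔ c₁ ⊔ ℓ₁ ⊔ p)
  π₁ = Image L₁._≈_ proj₂

-- A convex sublattice S of L₀ × L₁ is the rectangle π₀[S] × π₁[S]: if (a , b₁) and
-- (a₂ , b) lie in S, then (a , b) lies between their meet and their join.  Hence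
-- S ↦ (π₀[S] , π₁[S]) has inverse (A , B) ↦ A × B, and everything about π reduces
-- to the corresponding facts about rectangles A × B with nonempty sides.
module Submission where

open import Level using (Level; _⊔_)
open import Data.Product using (Σ; _×_; _,_; proj₁; proj₂)
open import Relation.Unary using (Pred; _≐_; _⟨×⟩_; Satisfiable)
open import Relation.Unary.Properties using (≐-sym; ≐-trans)
open import Relation.Binary.Core using (Rel)
open import Relation.Binary.Definitions using (_Respects_)
open import Relation.Binary.Lattice using (Lattice)

open import Defs

private
  variable
    a ℓ p q p' q' : Level
    X : Set a

module _ {_≤_ : Rel X ℓ} {_∧_ _∨_ : X → X → X} where

  isConvexSublattice-resp-≐ : {S : Pred X p} {T : Pred X q} → S ≐ T →
                              IsConvexSublattice _≤_ _∧_ _∨_ S →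
                              IsConvexSublattice _≤_ _∧_ _∨_ T
  isConvexSublattice-resp-≐ (S⊆T , T⊆S) C = record
    { nonempty = let (x , Sx) = nonempty in x , S⊆T Sx
    ; ∧-closed = λ Tx Ty → S⊆T (∧-closed (T⊆S Tx) (T⊆S Ty))
    ; ∨-closed = λ Tx Ty → S⊆T (∨-closed (T⊆S Tx) (T⊆S Ty))
    ; convex   = λ Tx Tz x≤y y≤z → S⊆T (convex (T⊆S Tx) (T⊆S Tz) x≤y y≤z)
    }
    where open IsConvexSublattice C

BiDom-resp-≐ : {_≤_ : Rel X ℓ} {S : Pred X p} {S' : Pred X p'} {T : Pred X q} {T' : Pred X q'} →
               S ≐ S' → T ≐ T' → BiDom _≤_ S T → BiDom _≤_ S' T'
BiDom-resp-≐ (S⊆S' , S'⊆S) (T⊆T' , T'⊆T) (up , down) =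
  (λ S'x → let (y , Ty , x≤y) = up (S'⊆S S'x) in y , T⊆T' Ty , x≤y) ,
  (λ T'y → let (x , Sx , x≤y) = down (T'⊆T T'y) in x , S⊆S' Sx , x≤y)

⟨×⟩-cong : ∀ {b} {B : Set b} {P : Pred X p} {P' : Pred X p'} {Q : Pred B q} {Q' : Pred B q'} →
           P ≐ P' → Q ≐ Q' → (P ⟨×⟩ Q) ≐ (P' ⟨×⟩ Q')
⟨×⟩-cong (P⊆P' , P'⊆P) (Q⊆Q' , Q'⊆Q) =
  (λ (Px , Qy) → P⊆P' Px , Q⊆Q' Qy) , (λ (P'x , Q'y) → P'⊆P P'x , Q'⊆Q Q'y)

module _ {c ℓ ℓ'} (L : Lattice c ℓ ℓ') where
  open Lattice L

  isConvexSublattice⇒respects : {S : Pred Carrier p} → IsConvexSublattice _≤_ _∧_ _∨_ S →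
                                S Respects _≈_
  isConvexSublattice⇒respects C x≈y Sx =
    IsConvexSublattice.convex C Sx Sx (reflexive x≈y) (reflexive (Eq.sym x≈y))

module ConvexSublatticeOfProduct {c₀ ℓ₀ ℓ₀' c₁ ℓ₁ ℓ₁' : Level}
         (L₀ : Lattice c₀ ℓ₀ ℓ₀') (L₁ : Lattice c₁ ℓ₁ ℓ₁') where
  private
    module L₀ = Lattice L₀
    module L₁ = Lattice L₁
  open Product L₀ L₁

  private
    IsConvexSublattice₀ : Pred L₀.Carrier p → Set (c₀ ⊔ ℓ₀' ⊔ p)
    IsConvexSublattice₀ = IsConvexSublattice L₀._≤_ L₀._∧_ L₀._∨_

    IsConvexSublattice₁ : Pred L₁.Carrier p → Set (c₁ ⊔ ℓ₁' ⊔ p)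
    IsConvexSublattice₁ = IsConvexSublattice L₁._≤_ L₁._∧_ L₁._∨_

    IsConvexSublattice× : Pred Carrier p → Set (c₀ ⊔ c₁ ⊔ ℓ₀' ⊔ ℓ₁' ⊔ p)
    IsConvexSublattice× = IsConvexSublattice _≤_ _∧_ _∨_

  module _ {A : Pred L₀.Carrier p} {B : Pred L₁.Carrier q} where

    ⟨×⟩-isConvexSublattice : IsConvexSublattice₀ A → IsConvexSublattice₁ B →
                             IsConvexSublattice× (A ⟨×⟩ B)
    ⟨×⟩-isConvexSublattice CA CB = record
      { nonempty = let (x , Ax) = A.nonempty ; (y , By) = B.nonempty in (x , y) , Ax , By
      ; ∧-closed = λ (Ax , Bx) (Ay , By) → A.∧-closed Ax Ay , B.∧-closed Bx By
      ; ∨-closed = λ (Ax , Bx) (Ay , By) → A.∨-closed Ax Ay , B.∨-closed Bx By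
      ; convex   = λ (Ax , Bx) (Az , Bz) (x≤y₀ , x≤y₁) (y≤z₀ , y≤z₁) →
                     A.convex Ax Az x≤y₀ y≤z₀ , B.convex Bx Bz x≤y₁ y≤z₁
      }
      where
      module A = IsConvexSublattice CA
      module B = IsConvexSublattice CB

    isConvexSublattice-⟨×⟩ˡ : IsConvexSublattice× (A ⟨×⟩ B) → IsConvexSublattice₀ A
    isConvexSublattice-⟨×⟩ˡ C with IsConvexSublattice.nonempty C
    ... | (x , y) , Ax , By = record
      { nonempty = x , Ax
      ; ∧-closed = λ Ax Az → proj₁ (∧-closed {_ , y} {_ , y} (Ax , By) (Az , By))
      ; ∨-closed = λ Ax Az → proj₁ (∨-closed {_ , y} {_ , y} (Ax , By) (Az , By))
      ; convex   = λ Ax Az x≤y y≤z →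
          proj₁ (convex {_ , y} {_ , y} {_ , y} (Ax , By) (Az , By) (x≤y , L₁.refl) (y≤z , L₁.refl))
      }
      where open IsConvexSublattice C

    isConvexSublattice-⟨×⟩ʳ : IsConvexSublattice× (A ⟨×⟩ B) → IsConvexSublattice₁ B
    isConvexSublattice-⟨×⟩ʳ C with IsConvexSublattice.nonempty C
    ... | (x , y) , Ax , By = record
      { nonempty = y , By
      ; ∧-closed = λ By Bz → proj₂ (∧-closed {x , _} {x , _} (Ax , By) (Ax , Bz))
      ; ∨-closed = λ By Bz → proj₂ (∨-closed {x , _} {x , _} (Ax , By) (Ax , Bz))
      ; convex   = λ Bx Bz x≤y y≤z →
          proj₂ (convex {x , _} {x , _} {x , _} (Ax , Bx) (Ax , Bz) (L₀.refl , x≤y) (L₀.refl , y≤z))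
      }
      where open IsConvexSublattice C

    π₀-⟨×⟩ : A Respects L₀._≈_ → Satisfiable B → π₀ (A ⟨×⟩ B) ≐ A
    π₀-⟨×⟩ resp (y , By) =
      (λ (_ , (Ax , _) , x≈x') → resp x≈x' Ax) , (λ {x} Ax → (x , y) , (Ax , By) , L₀.Eq.refl)

    π₁-⟨×⟩ : Satisfiable A → B Respects L₁._≈_ → π₁ (A ⟨×⟩ B) ≐ B
    π₁-⟨×⟩ (x , Ax) resp =
      (λ (_ , (_ , By) , y≈y') → resp y≈y' By) , (λ {y} By → (x , y) , (Ax , By) , L₁.Eq.refl)

  module _ {A : Pred L₀.Carrier p} {B : Pred L₁.Carrier q}
           {A' : Pred L₀.Carrier p'} {B' : Pred L₁.Carrier q'} where

    BiDom-⟨×⟩ : BiDom L₀._≤_ A A' → BiDom L₁._≤_ B B' → BiDom _≤_ (A ⟨×⟩ B) (A' ⟨×⟩ B')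
    BiDom-⟨×⟩ (up₀ , down₀) (up₁ , down₁) =
      (λ (Ax , Bx) → let (y₀ , A'y₀ , x≤y₀) = up₀ Ax ; (y₁ , B'y₁ , x≤y₁) = up₁ Bx
                      in (y₀ , y₁) , (A'y₀ , B'y₁) , (x≤y₀ , x≤y₁)) ,
      (λ (A'y , B'y) → let (x₀ , Ax₀ , x≤y₀) = down₀ A'y ; (x₁ , Bx₁ , x≤y₁) = down₁ B'y
                        in (x₀ , x₁) , (Ax₀ , Bx₁) , (x≤y₀ , x≤y₁))

    BiDom-⟨×⟩ˡ : Satisfiable B → Satisfiable B' →
                 BiDom _≤_ (A ⟨×⟩ B) (A' ⟨×⟩ B') → BiDom L₀._≤_ A A'
    BiDom-⟨×⟩ˡ (b , Bb) (b' , B'b') (up , down) =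
      (λ Ax → let ((y , _) , (A'y , _) , (x≤y , _)) = up {_ , b} (Ax , Bb) in y , A'y , x≤y) ,
      (λ A'y → let ((x , _) , (Ax , _) , (x≤y , _)) = down {_ , b'} (A'y , B'b') in x , Ax , x≤y)

    BiDom-⟨×⟩ʳ : Satisfiable A → Satisfiable A' →
                 BiDom _≤_ (A ⟨×⟩ B) (A' ⟨×⟩ B') → BiDom L₁._≤_ B B'
    BiDom-⟨×⟩ʳ (a , Aa) (a' , A'a') (up , down) =
      (λ Bx → let ((_ , y) , (_ , B'y) , (_ , x≤y)) = up {a , _} (Aa , Bx) in y , B'y , x≤y) ,
      (λ B'y → let ((_ , x) , (_ , Bx) , (_ , x≤y)) = down {a' , _} (A'a' , B'y) in x , Bx , x≤y)

  module _ {S : Pred Carrier p} (C : IsConvexSublattice× S) where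
    open IsConvexSublattice C

    rectangle : ∀ {s t x y} → S s → S t → proj₁ s L₀.≈ x → proj₂ t L₁.≈ y → S (x , y)
    rectangle {s₀ , s₁} {t₀ , t₁} Ss St s₀≈x t₁≈y =
      convex (∧-closed Ss St) (∨-closed Ss St)
        (L₀.trans (L₀.x∧y≤x s₀ t₀) (L₀.reflexive s₀≈x) , L₁.trans (L₁.x∧y≤y s₁ t₁) (L₁.reflexive t₁≈y))
        (L₀.trans (L₀.reflexive (L₀.Eq.sym s₀≈x)) (L₀.x≤x∨y s₀ t₀) ,
         L₁.trans (L₁.reflexive (L₁.Eq.sym t₁≈y)) (L₁.y≤x∨y s₁ t₁))

    ≐-π₀⟨×⟩π₁ : S ≐ (π₀ S ⟨×⟩ π₁ S)
    ≐-π₀⟨×⟩π₁ =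
      (λ Sx → (_ , Sx , L₀.Eq.refl) , (_ , Sx , L₁.Eq.refl)) ,
      (λ ((_ , Ss , s₀≈x) , (_ , St , t₁≈y)) → rectangle Ss St s₀≈x t₁≈y)

    π₀π₁-isConvexSublattice : IsConvexSublattice₀ (π₀ S) × IsConvexSublattice₁ (π₁ S)
    π₀π₁-isConvexSublattice =
      isConvexSublattice-⟨×⟩ˡ C' , isConvexSublattice-⟨×⟩ʳ C'
      where
      C' : IsConvexSublattice× (π₀ S ⟨×⟩ π₁ S)
      C' = isConvexSublattice-resp-≐ ≐-π₀⟨×⟩π₁ C

  module _ {S T : Pred Carrier p} (CS : IsConvexSublattice× S) (CT : IsConvexSublattice× T) where

    BiDom⇒BiDom-π : BiDom _≤_ S T → BiDom L₀._≤_ (π₀ S) (π₀ T) × BiDom L₁._≤_ (π₁ S) (π₁ T)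
    BiDom⇒BiDom-π S≤T =
      BiDom-⟨×⟩ˡ (nonempty (proj₂ CS')) (nonempty (proj₂ CT')) S≤T' ,
      BiDom-⟨×⟩ʳ (nonempty (proj₁ CS')) (nonempty (proj₁ CT')) S≤T'
      where
      open IsConvexSublattice using (nonempty)
      CS' : IsConvexSublattice₀ (π₀ S) × IsConvexSublattice₁ (π₁ S)
      CS' = π₀π₁-isConvexSublattice CS
      CT' : IsConvexSublattice₀ (π₀ T) × IsConvexSublattice₁ (π₁ T)
      CT' = π₀π₁-isConvexSublattice CT
      S≤T' : BiDom _≤_ (π₀ S ⟨×⟩ π₁ S) (π₀ T ⟨×⟩ π₁ T)
      S≤T' = BiDom-resp-≐ (≐-π₀⟨×⟩π₁ CS) (≐-π₀⟨×⟩π₁ CT) S≤T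

    BiDom-π⇒BiDom : BiDom L₀._≤_ (π₀ S) (π₀ T) × BiDom L₁._≤_ (π₁ S) (π₁ T) → BiDom _≤_ S T
    BiDom-π⇒BiDom (π₀S≤π₀T , π₁S≤π₁T) =
      BiDom-resp-≐ (≐-sym (≐-π₀⟨×⟩π₁ CS)) (≐-sym (≐-π₀⟨×⟩π₁ CT)) (BiDom-⟨×⟩ π₀S≤π₀T π₁S≤π₁T)

    π-injective : π₀ S ≐ π₀ T → π₁ S ≐ π₁ T → S ≐ T
    π-injective π₀S≐π₀T π₁S≐π₁T =
      ≐-trans (≐-π₀⟨×⟩π₁ CS) (≐-trans (⟨×⟩-cong π₀S≐π₀T π₁S≐π₁T) (≐-sym (≐-π₀⟨×⟩π₁ CT)))

  module _ {A : Pred L₀.Carrier p} {B : Pred L₁.Carrier q}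
           (CA : IsConvexSublattice₀ A) (CB : IsConvexSublattice₁ B) where

    π-⟨×⟩ : π₀ (A ⟨×⟩ B) ≐ A × π₁ (A ⟨×⟩ B) ≐ B
    π-⟨×⟩ = π₀-⟨×⟩ (isConvexSublattice⇒respects L₀ CA) (IsConvexSublattice.nonempty CB) ,
            π₁-⟨×⟩ (IsConvexSublattice.nonempty CA) (isConvexSublattice⇒respects L₁ CB)

mainTheorem11 : ∀ {c₀ ℓ₀ ℓ₀' c₁ ℓ₁ ℓ₁' p : _}
    (L₀ : Lattice c₀ ℓ₀ ℓ₀') (L₁ : Lattice c₁ ℓ₁ ℓ₁') →
    let module L₀ = Lattice L₀
        module L₁ = Lattice L₁
        module P = Product L₀ L₁
        CL = IsConvexSublattice P._≤_ P._∧_ P._∨_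
        CL₀ = IsConvexSublattice L₀._≤_ L₀._∧_ L₀._∨_
        CL₁ = IsConvexSublattice L₁._≤_ L₁._∧_ L₁._∨_
    in
    ((S : Pred P.Carrier p) → CL S → CL₀ (P.π₀ S) × CL₁ (P.π₁ S))
    × ((S T : Pred P.Carrier p) → CL S → CL T →
        (BiDom P._≤_ S T →
           BiDom L₀._≤_ (P.π₀ S) (P.π₀ T) × BiDom L₁._≤_ (P.π₁ S) (P.π₁ T))
        × (BiDom L₀._≤_ (P.π₀ S) (P.π₀ T) × BiDom L₁._≤_ (P.π₁ S) (P.π₁ T) →
           BiDom P._≤_ S T))
    × ((S T : Pred P.Carrier p) → CL S → CL T →
        P.π₀ S ≐ P.π₀ T → P.π₁ S ≐ P.π₁ T → S ≐ T)
    × ((A : Pred L₀.Carrier p) (B : Pred L₁.Carrier p) → CL₀ A → CL₁ B →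
        Σ (Pred P.Carrier p) λ S → CL S × (P.π₀ S ≐ A) × (P.π₁ S ≐ B))
mainTheorem11 L₀ L₁ =
  (λ S → π₀π₁-isConvexSublattice)
  , (λ S T CS CT → BiDom⇒BiDom-π CS CT , BiDom-π⇒BiDom CS CT)
  , (λ S T → π-injective)
  , (λ A B CA CB → (A ⟨×⟩ B) , ⟨×⟩-isConvexSublattice CA CB , π-⟨×⟩ CA CB)
  where open ConvexSublatticeOfProduct L₀ L₁
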